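{- Let $a\in\mathbb{N}$ with binary expansion $a=\sum_{k\ge0}a_k2^k$. For $n\in\mathbb{N}$ write $r_n=a\bmod 2^n$ and define $\eta^1_{a,n},\eta^2_{a,n}\in l^1(\mathbb{Z})$ by $$\eta^1_{a,n}(d)=2^{ -n}\#\{u\in\{0,\dots,2^n-1\}: u+r_n<2^n,\ s_2(u+r_n)-s_2(u)=d\},$$ $$\eta^2_{a,n}(d)=2^{ -n}\#\{u\in\{0,\dots,2^n-1\}: u+r_n\ge 2^n,\ s_2(u+r_n-2^n)-s_2(u)=d\}$$ (so $\eta^1_{a,0}=\delta_0$, $\eta^2_{a,0}=0$). Then for all $n\in\mathbb{N}$, $$\begin{pmatrix}\eta^1_{a,n+1}\\ \eta^2_{a,n+1}\end{pmatrix}=A_{a_n}\begin{pmatrix}\eta^1_{a,n}\\ \eta^2_{a,n}\end{pmatrix},$$ where $A_0=\begin{pmatrix} Id & \tfrac12 S^{ -1}\\ 0 & \tfrac12 S\end{pmatrix}$, $A_1=\begin{pmatrix} \tfrac12 S^{ -1} & 0\\ \tfrac12 S & Id\end{pmatrix}$.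
   Context: $s_2(y)$ is the number of digits $1$ in the binary expansion of $y\in\mathbb{N}$. $S$ is the left shift on $l^1(\mathbb{Z})$, $(Su)(d)=u(d+1)$; $\delta_0$ is the Dirac mass at $0$. Equivalently (as in the paper), $\eta^i_{a,n}(d)$ is the probability that a uniformly random binary path of length $n$ in the "summation graph" of $a$ ends, at level $n$, at the vertex with carry $i-1$ (i.e. remaining value $\lfloor a/2^n\rfloor+i-1$) with counter value $d$, where the counter records the change in the number of $1$'s produced so far during digit-by-digit addition of $a$. -}

module Defs where

open import Data.Nat as ℕ using (ℕ; zero; suc; _^_; _<?_; _≤?_; NonZero)
open import Data.Nat.Properties using (m^n≢0)
open import Data.Nat.DivMod using (_mod_)
open import Data.Fin using (Fin)
open import Data.Integer as ℤ using (ℤ; +_; _⊖_)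
open import Data.Rational as ℚ using (ℚ; ½)
open import Data.List using (List; upTo; filter; length; map)
open import Data.Nat.ListAction using (sum)
open import Data.Product using (_×_; _,_)
open import Relation.Nullary.Decidable using (_×-dec_)
open import Relation.Binary.PropositionalEquality using (_≡_)

2^-nz : (n : ℕ) → NonZero (2 ^ n)
2^-nz n = m^n≢0 2 n

bit : ℕ → ℕ → ℕ
bit a k = ℕ._%_ (ℕ._/_ a (2 ^ k) {{2^-nz k}}) 2

digit : ℕ → ℕ → Fin 2
digit a k = (ℕ._/_ a (2 ^ k) {{2^-nz k}}) mod 2

-- s₂(y): number of ones in the binary expansion of y
-- (digits of index ≥ y vanish since 2^k > k, so summing over k ≤ y suffices)
s₂ : ℕ → ℕ
s₂ y = sum (map (bit y) (upTo (suc y)))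

r : ℕ → ℕ → ℕ
r a n = ℕ._%_ a (2 ^ n) {{2^-nz n}}

-- elements of l¹(ℤ) with rational values, as functions ℤ → ℚ
Seq : Set
Seq = ℤ → ℚ

S : Seq → Seq
S u d = u (d ℤ.+ ℤ.+ 1)

S⁻¹ : Seq → Seq
S⁻¹ u d = u (d ℤ.- ℤ.+ 1)

half : Seq → Seq
half u d = ½ ℚ.* u d

_⊕_ : Seq → Seq → Seq
(u ⊕ v) d = u d ℚ.+ v d

A : Fin 2 → Seq × Seq → Seq × Seq
A Fin.zero (x , y) = (x ⊕ half (S⁻¹ y)) , half (S y)
A (Fin.suc Fin.zero) (x , y) = half (S⁻¹ x) , (half (S x) ⊕ y)

count1 : ℕ → ℕ → ℤ → ℕ
count1 a n d = length (filter
  (λ u → ((u ℕ.+ r a n) <? 2 ^ n) ×-dec (ℤ._≟_ (s₂ (u ℕ.+ r a n) ⊖ s₂ u) d))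
  (upTo (2 ^ n)))

count2 : ℕ → ℕ → ℤ → ℕ
count2 a n d = length (filter
  (λ u → ((2 ^ n) ≤? (u ℕ.+ r a n)) ×-dec (ℤ._≟_ (s₂ ((u ℕ.+ r a n) ℕ.∸ 2 ^ n) ⊖ s₂ u) d))
  (upTo (2 ^ n)))

η¹ : ℕ → ℕ → Seq
η¹ a n d = ℚ._/_ (+ count1 a n d) (2 ^ n) {{2^-nz n}}

η² : ℕ → ℕ → Seq
η² a n d = ℚ._/_ (+ count2 a n d) (2 ^ n) {{2^-nz n}}

module Submission where

-- Write N = 2^n, R = r_n < N and 2^(n+1) = N + N.  For a summand u < N and v = u + R, the
-- event counted by η¹ (no carry out of the n lowest digits, counter s₂ v − s₂ u = d) and the
-- one counted by η² (a carry, counter s₂ (v − N) − s₂ u = d) depend only on v and k = s₂ u;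
-- they are named NoCarry n d v k and Carry n d v k.  Splitting the summands u < 2^(n+1) into
-- the lower half u and the upper half N + u, and the new remainder r_{n+1} into R (digit
-- a_n = 0) or N + R (digit a_n = 1), every event at level n+1 becomes an event at level n
-- with the counter shifted by at most one.  The only fact on binary expansions used is
-- s₂ (N + x) = 1 + s₂ x for x < N.  This yields four recurrences for the counts
-- (C₁-step-0, C₂-step-0, C₁-step-1, C₂-step-1); divided by 2^(n+1) they are the entries of
-- A₀ and A₁.

open import Defs
open import Data.Nat using (ℕ; suc)
open import Data.Integer using (ℤ)
open import Data.Product using (_×_; _,_; proj₁; proj₂)
open import Relation.Binary.PropositionalEquality using (_≡_)

open import Data.Nat using (zero; _+_; _*_; _^_; _<_; _≤_; _∸_; _%_; _/_; _<?_; _≤?_; NonZero; z≤n; s≤s)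
open import Data.Nat.Properties
  using ( +-identityʳ; +-suc; +-assoc; *-comm; ≤-refl; <⇒≱; ≮⇒≥; m<n⇒m<1+n; m≤m+n; m^n>0
        ; +-mono-≤; +-mono-<; +-monoʳ-≤; +-monoʳ-<; +-cancelˡ-≤; +-cancelˡ-<
        ; m+[n∸m]≡n; [m+n]∸[m+o]≡n∸o; m+n∸m≡n; +-commutativeSemigroup )
import Data.Nat.Properties as ℕP
open import Data.Nat.DivMod
  using ( m%n<n; n/1≡n; m/n/o≡m/[n*o]; m<n*o⇒m/o<n; %-remove-+ˡ; +-distrib-/-∣ˡ; m*n/n≡m
        ; m≡m%n+[m/n]*n; m∣n⇒o%n%m≡o%m; m%[n*o]/o≡m/o%n )
open import Data.Nat.Divisibility using (m∣m*n; n∣m*n)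
open import Data.Nat.ListAction using (sum)
open import Algebra.Properties.CommutativeSemigroup +-commutativeSemigroup using (interchange; x∙yz≈y∙xz)
open import Data.Integer as ℤ using (_⊖_; 1ℤ)
import Data.Integer.Properties as ℤP
open import Data.Integer.Solver using (module +-*-Solver)
open import Data.Rational as ℚ using (ℚ; ½; toℚᵘ)
import Data.Rational.Properties as ℚP
open import Data.Rational.Unnormalised as ℚᵘ using (ℚᵘ; mkℚᵘ; *≡*) renaming (_≃_ to _≃ᵘ_)
open import Data.Rational.Unnormalised.Properties using (≃-trans; ≃-sym; ≃-refl; +-cong; *-cong)
open import Data.Fin as Fin using (Fin)
open import Data.Fin.Properties using (toℕ-fromℕ<)
open import Data.List using (_∷_; []; _++_; _∷ʳ_; upTo; applyUpTo; filter; length)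
open import Data.List.Properties using (upTo-∷ʳ; filter-++; length-++; map-upTo)
open import Data.Sum using (_⊎_; inj₁; inj₂; [_,_])
open import Data.Empty using (⊥; ⊥-elim)
open import Data.Product.Function.NonDependent.Propositional using (_×-⇔_)
open import Data.Sum.Function.Propositional using (_⊎-⇔_)
open import Function using (_∘_; _⇔_; Equivalence; mk⇔)
open import Function.Properties.Equivalence using (⇔-isEquivalence)
open import Level using (0ℓ)
open import Relation.Binary.Structures using (IsEquivalence)
open import Relation.Nullary using (Dec; yes; no; ¬_)
open import Relation.Nullary.Decidable using (_×-dec_)
open import Relation.Binary.PropositionalEquality using (refl; sym; trans; cong; cong₂; subst; module ≡-Reasoning)

open Equivalence using (to; from)
open ≡-Reasoning
module ⇔ = IsEquivalence (⇔-isEquivalence {0ℓ})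

≡⇒⇔ : {X Y : Set} → X ≡ Y → X ⇔ Y
≡⇒⇔ refl = ⇔.refl

2^suc : (n : ℕ) → 2 ^ suc n ≡ 2 ^ n + 2 ^ n
2^suc n = cong (2 ^ n +_) (+-identityʳ (2 ^ n))

module Counting where

  ind : {X : Set} → Dec X → ℕ
  ind (yes _) = 1
  ind (no _) = 0

  count : {P : ℕ → Set} → (∀ u → Dec (P u)) → ℕ → ℕ
  count P? n = length (filter P? (upTo n))

  length-filter-singleton : {P : ℕ → Set} (P? : ∀ u → Dec (P u)) (n : ℕ) → length (filter P? (n ∷ [])) ≡ ind (P? n)
  length-filter-singleton P? n with P? n
  ... | yes _ = refl
  ... | no _ = refl

  count-suc : {P : ℕ → Set} (P? : ∀ u → Dec (P u)) (n : ℕ) → count P? (suc n) ≡ count P? n + ind (P? n)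
  count-suc P? n = begin
    length (filter P? (upTo (suc n)))                 ≡⟨ cong (length ∘ filter P?) (sym (upTo-∷ʳ n)) ⟩
    length (filter P? (upTo n ∷ʳ n))                  ≡⟨ cong length (filter-++ P? (upTo n) (n ∷ [])) ⟩
    length (filter P? (upTo n) ++ filter P? (n ∷ [])) ≡⟨ length-++ (filter P? (upTo n)) ⟩
    count P? n + length (filter P? (n ∷ []))          ≡⟨ cong (count P? n +_) (length-filter-singleton P? n) ⟩
    count P? n + ind (P? n)                           ∎

  count-+ : {P : ℕ → Set} (P? : ∀ u → Dec (P u)) (m n : ℕ) →
    count P? (m + n) ≡ count P? m + count (λ u → P? (m + u)) n
  count-+ P? m zero = trans (cong (count P?) (+-identityʳ m)) (sym (+-identityʳ (count P? m)))
  count-+ {P} P? m (suc n) = begin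
    count P? (m + suc n)                                        ≡⟨ cong (count P?) (+-suc m n) ⟩
    count P? (suc (m + n))                                      ≡⟨ count-suc P? (m + n) ⟩
    count P? (m + n) + ind (P? (m + n))                         ≡⟨ cong (_+ ind (P? (m + n))) (count-+ P? m n) ⟩
    count P? m + count Q? n + ind (Q? n)                        ≡⟨ +-assoc (count P? m) (count Q? n) (ind (Q? n)) ⟩
    count P? m + (count Q? n + ind (Q? n))                      ≡⟨ cong (count P? m +_) (sym (count-suc Q? n)) ⟩
    count P? m + count Q? (suc n)                               ∎
    where
      Q? : ∀ u → Dec (P (m + u))
      Q? u = P? (m + u)

  count-halves : {P : ℕ → Set} (P? : ∀ u → Dec (P u)) (n : ℕ) →
    count P? (2 ^ suc n) ≡ count P? (2 ^ n) + count (λ u → P? (2 ^ n + u)) (2 ^ n)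
  count-halves P? n = trans (cong (count P?) (2^suc n)) (count-+ P? (2 ^ n) (2 ^ n))

  ind-⊎ : {X Y Z : Set} (x : Dec X) (y : Dec Y) (z : Dec Z) →
    X ⇔ (Y ⊎ Z) → (Y → Z → ⊥) → ind x ≡ ind y + ind z
  ind-⊎ (yes _) (yes y) (yes z) _ disjoint = ⊥-elim (disjoint y z)
  ind-⊎ (yes _) (yes _) (no _) _ _ = refl
  ind-⊎ (yes _) (no _) (yes _) _ _ = refl
  ind-⊎ (yes x) (no ¬y) (no ¬z) X⇔Y⊎Z _ = ⊥-elim ([ ¬y , ¬z ] (to X⇔Y⊎Z x))
  ind-⊎ (no ¬x) (yes y) _ X⇔Y⊎Z _ = ⊥-elim (¬x (from X⇔Y⊎Z (inj₁ y)))
  ind-⊎ (no ¬x) (no _) (yes z) X⇔Y⊎Z _ = ⊥-elim (¬x (from X⇔Y⊎Z (inj₂ z)))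
  ind-⊎ (no _) (no _) (no _) _ _ = refl

  count-⊎ : {P Q R : ℕ → Set} (P? : ∀ u → Dec (P u)) (Q? : ∀ u → Dec (Q u)) (R? : ∀ u → Dec (R u)) (n : ℕ) →
    (∀ u → u < n → P u ⇔ (Q u ⊎ R u)) → (∀ u → Q u → R u → ⊥) →
    count P? n ≡ count Q? n + count R? n
  count-⊎ P? Q? R? zero _ _ = refl
  count-⊎ P? Q? R? (suc n) P⇔Q⊎R disjoint = begin
    count P? (suc n)                                        ≡⟨ count-suc P? n ⟩
    count P? n + ind (P? n)                                 ≡⟨ cong₂ _+_ below last ⟩
    (count Q? n + count R? n) + (ind (Q? n) + ind (R? n))   ≡⟨ interchange (count Q? n) (count R? n) (ind (Q? n)) (ind (R? n)) ⟩
    (count Q? n + ind (Q? n)) + (count R? n + ind (R? n))   ≡⟨ sym (cong₂ _+_ (count-suc Q? n) (count-suc R? n)) ⟩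
    count Q? (suc n) + count R? (suc n)                     ∎
    where
      below : count P? n ≡ count Q? n + count R? n
      below = count-⊎ P? Q? R? n (λ u u<n → P⇔Q⊎R u (m<n⇒m<1+n u<n)) disjoint
      last : ind (P? n) ≡ ind (Q? n) + ind (R? n)
      last = ind-⊎ (P? n) (Q? n) (R? n) (P⇔Q⊎R n ≤-refl) (disjoint n)

  count-none : {P : ℕ → Set} (P? : ∀ u → Dec (P u)) (n : ℕ) → (∀ u → u < n → ¬ P u) → count P? n ≡ 0
  count-none P? zero _ = refl
  count-none P? (suc n) ¬P = begin
    count P? (suc n)          ≡⟨ count-suc P? n ⟩
    count P? n + ind (P? n)   ≡⟨ cong₂ _+_ (count-none P? n (λ u u<n → ¬P u (m<n⇒m<1+n u<n))) (ind-no (P? n) (¬P n ≤-refl)) ⟩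
    0                         ∎
    where
      ind-no : {X : Set} (x : Dec X) → ¬ X → ind x ≡ 0
      ind-no (yes x) ¬x = ⊥-elim (¬x x)
      ind-no (no _) _ = refl

  count-⇔ : {P Q : ℕ → Set} (P? : ∀ u → Dec (P u)) (Q? : ∀ u → Dec (Q u)) (n : ℕ) →
    (∀ u → u < n → P u ⇔ Q u) → count P? n ≡ count Q? n
  count-⇔ P? Q? n P⇔Q = begin
    count P? n                   ≡⟨ count-⊎ P? Q? never n (λ u u<n → mk⇔ (inj₁ ∘ to (P⇔Q u u<n)) [ from (P⇔Q u u<n) , (λ ()) ]) (λ _ _ ()) ⟩
    count Q? n + count never n   ≡⟨ cong (count Q? n +_) (count-none never n (λ _ _ ())) ⟩
    count Q? n + 0               ≡⟨ +-identityʳ (count Q? n) ⟩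
    count Q? n                   ∎
    where
      never : ∀ u → Dec ⊥
      never _ = no (λ ())

module Binary where

  popcount : ℕ → ℕ → ℕ
  popcount y K = sum (applyUpTo (bit y) K)

  applyUpTo-cong : {f g : ℕ → ℕ} (K : ℕ) → (∀ k → f k ≡ g k) → applyUpTo f K ≡ applyUpTo g K
  applyUpTo-cong zero _ = refl
  applyUpTo-cong (suc K) f≗g = cong₂ _∷_ (f≗g 0) (applyUpTo-cong K (f≗g ∘ suc))

  popcount-suc : (y K : ℕ) → popcount y (suc K) ≡ y % 2 + popcount (y / 2) K
  popcount-suc y K = cong₂ _+_ (cong (_% 2) (n/1≡n y)) (cong sum (applyUpTo-cong K bit-suc))
    where
      bit-suc : ∀ k → bit y (suc k) ≡ bit (y / 2) k
      bit-suc k = cong (_% 2) (sym (m/n/o≡m/[n*o] y 2 (2 ^ k) {{_}} {{2^-nz k}} {{2^-nz (suc k)}}))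

  popcount-zero : (K : ℕ) → popcount 0 K ≡ 0
  popcount-zero zero = refl
  popcount-zero (suc K) = trans (popcount-suc 0 K) (popcount-zero K)

  half-< : {y K : ℕ} → y < 2 ^ suc K → y / 2 < 2 ^ K
  half-< {y} {K} y< = m<n*o⇒m/o<n (subst (y <_) (*-comm 2 (2 ^ K)) y<)

  popcount-stable : (K m : ℕ) {y : ℕ} → y < 2 ^ K → popcount y (K + m) ≡ popcount y K
  popcount-stable zero m {zero} _ = popcount-zero m
  popcount-stable zero m {suc y} (s≤s ())
  popcount-stable (suc K) m {y} y< = begin
    popcount y (suc K + m)               ≡⟨ popcount-suc y (K + m) ⟩
    y % 2 + popcount (y / 2) (K + m)     ≡⟨ cong (y % 2 +_) (popcount-stable K m (half-< {K = K} y<)) ⟩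
    y % 2 + popcount (y / 2) K           ≡⟨ sym (popcount-suc y K) ⟩
    popcount y (suc K)                   ∎

  n<2^n : (n : ℕ) → n < 2 ^ n
  n<2^n zero = s≤s z≤n
  n<2^n (suc n) = subst (suc n <_) (sym (2^suc n)) (+-mono-≤ (m^n>0 2 n) (n<2^n n))

  2^n<2^suc : (n : ℕ) → 2 ^ n < 2 ^ suc n
  2^n<2^suc n = ℕP.^-monoʳ-< 2 (s≤s (s≤s z≤n)) (ℕP.n<1+n n)

  s₂≡popcount : (K : ℕ) {y : ℕ} → y < 2 ^ K → s₂ y ≡ popcount y K
  s₂≡popcount K {y} y< = begin
    s₂ y                      ≡⟨ cong sum (map-upTo (bit y) (suc y)) ⟩
    popcount y (suc y)        ≡⟨ sym (popcount-stable (suc y) K (ℕP.<-trans (n<2^n y) (2^n<2^suc y))) ⟩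
    popcount y (suc y + K)    ≡⟨ cong (popcount y) (ℕP.+-comm (suc y) K) ⟩
    popcount y (K + suc y)    ≡⟨ popcount-stable K (suc y) y< ⟩
    popcount y K              ∎

  -- The digit 2^n sits at position n, above all digits of x < 2^n.
  popcount-top : (n : ℕ) {x : ℕ} → x < 2 ^ n → popcount (2 ^ n + x) (suc n) ≡ suc (popcount x n)
  popcount-top zero {zero} _ = refl
  popcount-top zero {suc x} (s≤s ())
  popcount-top (suc n) {x} x< = begin
    popcount (2 ^ suc n + x) (suc (suc n))                     ≡⟨ popcount-suc (2 ^ suc n + x) (suc n) ⟩
    (2 ^ suc n + x) % 2 + popcount ((2 ^ suc n + x) / 2) (suc n)
      ≡⟨ cong₂ (λ b y → b + popcount y (suc n)) (%-remove-+ˡ x (m∣m*n (2 ^ n))) halve ⟩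
    x % 2 + popcount (2 ^ n + x / 2) (suc n)                   ≡⟨ cong (x % 2 +_) (popcount-top n (half-< {K = n} x<)) ⟩
    x % 2 + suc (popcount (x / 2) n)                           ≡⟨ +-suc (x % 2) _ ⟩
    suc (x % 2 + popcount (x / 2) n)                           ≡⟨ cong suc (sym (popcount-suc x n)) ⟩
    suc (popcount x (suc n))                                   ∎
    where
      halve : (2 ^ suc n + x) / 2 ≡ 2 ^ n + x / 2
      halve = trans (+-distrib-/-∣ˡ x (m∣m*n (2 ^ n)))
                    (cong (_+ x / 2) (trans (cong (_/ 2) (*-comm 2 (2 ^ n))) (m*n/n≡m (2 ^ n) 2)))

  s₂-top : (n : ℕ) {x : ℕ} → x < 2 ^ n → s₂ (2 ^ n + x) ≡ suc (s₂ x)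
  s₂-top n {x} x< = begin
    s₂ (2 ^ n + x)              ≡⟨ s₂≡popcount (suc n) (subst (2 ^ n + x <_) (sym (2^suc n)) (+-monoʳ-< (2 ^ n) x<)) ⟩
    popcount (2 ^ n + x) (suc n) ≡⟨ popcount-top n x< ⟩
    suc (popcount x n)           ≡⟨ cong suc (sym (s₂≡popcount n x<)) ⟩
    suc (s₂ x)                   ∎

  r-suc : (a n : ℕ) → r a (suc n) ≡ r a n + bit a n * 2 ^ n
  r-suc a n = begin
    r a (suc n)                                  ≡⟨ m≡m%n+[m/n]*n (r a (suc n)) N {{2^-nz n}} ⟩
    _%_ (r a (suc n)) N {{2^-nz n}} + _/_ (r a (suc n)) N {{2^-nz n}} * N
      ≡⟨ cong₂ (λ x y → x + y * N) low high ⟩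
    r a n + bit a n * N                          ∎
    where
      N : ℕ
      N = 2 ^ n
      low : _%_ (r a (suc n)) N {{2^-nz n}} ≡ r a n
      low = m∣n⇒o%n%m≡o%m N (2 * N) a {{2^-nz n}} {{2^-nz (suc n)}} (n∣m*n 2)
      high : _/_ (r a (suc n)) N {{2^-nz n}} ≡ bit a n
      high = m%[n*o]/o≡m/o%n a 2 N {{_}} {{2^-nz n}} {{2^-nz (suc n)}}

module Differences where
  open +-*-Solver

  add-one : (z d : ℤ) → (1ℤ ℤ.+ z ≡ d) ⇔ (z ≡ d ℤ.- 1ℤ)
  add-one z d = mk⇔ (λ e → trans (sym (cancel z)) (cong (ℤ._- 1ℤ) e)) (λ e → trans (cong (λ w → 1ℤ ℤ.+ w) e) (restore d))
    where
      cancel : ∀ z → 1ℤ ℤ.+ z ℤ.- 1ℤ ≡ z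
      cancel = solve 1 (λ z → con 1ℤ :+ z :- con 1ℤ := z) refl
      restore : ∀ d → 1ℤ ℤ.+ (d ℤ.- 1ℤ) ≡ d
      restore = solve 1 (λ d → con 1ℤ :+ (d :- con 1ℤ) := d) refl

  suc-⊖ : (x y : ℕ) (d : ℤ) → (suc x ⊖ y ≡ d) ⇔ (x ⊖ y ≡ d ℤ.- 1ℤ)
  suc-⊖ x y d = ⇔.trans (≡⇒⇔ (cong (_≡ d) (sym (ℤP.distribʳ-⊖-+-pos 1 x y)))) (add-one (x ⊖ y) d)

  suc-⊖-suc : (x y : ℕ) (d : ℤ) → (suc x ⊖ suc y ≡ d) ⇔ (x ⊖ y ≡ d)
  suc-⊖-suc x y d = ≡⇒⇔ (cong (_≡ d) (ℤP.[1+m]⊖[1+n]≡m⊖n x y))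

  -- One more 1 in the summand u: the rest must differ by d + 1, since
  -- x ⊖ suc y ≡ d  ⇔  suc x ⊖ suc y ≡ d + 1  ⇔  x ⊖ y ≡ d + 1.
  ⊖-suc : (x y : ℕ) (d : ℤ) → (x ⊖ suc y ≡ d) ⇔ (x ⊖ y ≡ d ℤ.+ 1ℤ)
  ⊖-suc x y d = ⇔.trans (⇔.trans shift (⇔.sym (suc-⊖ x (suc y) (d ℤ.+ 1ℤ)))) (suc-⊖-suc x y (d ℤ.+ 1ℤ))
    where
      shift : (x ⊖ suc y ≡ d) ⇔ (x ⊖ suc y ≡ d ℤ.+ 1ℤ ℤ.- 1ℤ)
      shift = ≡⇒⇔ (cong (x ⊖ suc y ≡_) (sym (solve 1 (λ d → d :+ con 1ℤ :- con 1ℤ := d) refl d)))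

-- The two events behind η¹ and η² at level m, as properties of the sum v = u + R and of k = s₂ u.
module Events where
  open Binary using (s₂-top)
  open Differences

  NoCarry : ℕ → ℤ → ℕ → ℕ → Set
  NoCarry m d v k = v < 2 ^ m × s₂ v ⊖ k ≡ d

  Carry : ℕ → ℤ → ℕ → ℕ → Set
  Carry m d v k = 2 ^ m ≤ v × s₂ (v ∸ 2 ^ m) ⊖ k ≡ d

  -- Deciders, of exactly the shape of the filters in count1 and count2.
  noCarry? : (m : ℕ) (d : ℤ) (v k : ℕ) → Dec (NoCarry m d v k)
  noCarry? m d v k = (v <? 2 ^ m) ×-dec (s₂ v ⊖ k ℤ.≟ d)

  carry? : (m : ℕ) (d : ℤ) (v k : ℕ) → Dec (Carry m d v k)
  carry? m d v k = (2 ^ m ≤? v) ×-dec (s₂ (v ∸ 2 ^ m) ⊖ k ℤ.≟ d)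

  reindex : (E : ℕ → ℕ → Set) {v v′ k k′ : ℕ} → v ≡ v′ → k ≡ k′ → E v k ⇔ E v′ k′
  reindex E refl refl = ⇔.refl

  -- Below 2^(n+1), a number at least 2^n is 2^n plus a number below 2^n.
  s₂-above : (n : ℕ) {v : ℕ} → 2 ^ n ≤ v → v < 2 ^ suc n → s₂ v ≡ suc (s₂ (v ∸ 2 ^ n))
  s₂-above n {v} ≤v v< = trans (cong s₂ (sym (m+[n∸m]≡n ≤v))) (s₂-top n rest<)
    where
      rest< : v ∸ 2 ^ n < 2 ^ n
      rest< = +-cancelˡ-< (2 ^ n) _ _ (subst (_< 2 ^ n + 2 ^ n) (sym (m+[n∸m]≡n ≤v)) (subst (v <_) (2^suc n) v<))

  -- No carry at level n+1 splits according to the carry at level n; the carry branch is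
  -- described by any E equivalent to the counter condition there.
  split-level : (n : ℕ) {d : ℤ} {v k : ℕ} {E : Set} → v < 2 ^ suc n →
    (2 ^ n ≤ v → (s₂ v ⊖ k ≡ d) ⇔ E) → NoCarry (suc n) d v k ⇔ (NoCarry n d v k ⊎ (2 ^ n ≤ v × E))
  split-level n {v = v} v< branch with v <? 2 ^ n
  ... | yes v<N = mk⇔ (λ (_ , e) → inj₁ (v<N , e)) [ (λ (_ , e) → v< , e) , (λ (≤v , _) → ⊥-elim (<⇒≱ v<N ≤v)) ]
  ... | no v≮N = mk⇔ (λ (_ , e) → inj₂ (≮⇒≥ v≮N , to (branch (≮⇒≥ v≮N)) e))
                     [ (λ (v<N , _) → ⊥-elim (v≮N v<N)) , (λ (≤v , e) → v< , from (branch ≤v) e) ]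

  shift-no-carry : (n : ℕ) {d d′ : ℤ} {v k k′ : ℕ} →
    (v < 2 ^ n → (s₂ (2 ^ n + v) ⊖ k′ ≡ d) ⇔ (s₂ v ⊖ k ≡ d′)) →
    NoCarry (suc n) d (2 ^ n + v) k′ ⇔ NoCarry n d′ v k
  shift-no-carry n {v = v} counter = mk⇔
    (λ (v< , e) → let v<N = lower v< in v<N , to (counter v<N) e)
    (λ (v<N , e) → subst (2 ^ n + v <_) (sym (2^suc n)) (+-monoʳ-< (2 ^ n) v<N) , from (counter v<N) e)
    where
      lower : 2 ^ n + v < 2 ^ suc n → v < 2 ^ n
      lower v< = +-cancelˡ-< (2 ^ n) _ _ (subst (2 ^ n + v <_) (2^suc n) v<)

  shift-carry : (n : ℕ) {d d′ : ℤ} {v k k′ : ℕ} →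
    (s₂ (v ∸ 2 ^ n) ⊖ k′ ≡ d) ⇔ (s₂ (v ∸ 2 ^ n) ⊖ k ≡ d′) →
    Carry (suc n) d (2 ^ n + v) k′ ⇔ Carry n d′ v k
  shift-carry n {d} {v = v} {k′ = k′} counter = reindex-top ×-⇔ ⇔.trans (≡⇒⇔ (cong (λ w → s₂ w ⊖ k′ ≡ d) rest)) counter
    where
      reindex-top : (2 ^ suc n ≤ 2 ^ n + v) ⇔ (2 ^ n ≤ v)
      reindex-top = mk⇔ (λ le → +-cancelˡ-≤ (2 ^ n) _ _ (subst (_≤ 2 ^ n + v) (2^suc n) le))
                        (λ le → subst (_≤ 2 ^ n + v) (sym (2^suc n)) (+-monoʳ-≤ (2 ^ n) le))
      rest : 2 ^ n + v ∸ 2 ^ suc n ≡ v ∸ 2 ^ n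
      rest = trans (cong (2 ^ n + v ∸_) (2^suc n)) ([m+n]∸[m+o]≡n∸o (2 ^ n) v (2 ^ n))

  split-no-carry : (n : ℕ) {d : ℤ} {v k : ℕ} → v < 2 ^ suc n →
    NoCarry (suc n) d v k ⇔ (NoCarry n d v k ⊎ Carry n (d ℤ.- 1ℤ) v k)
  split-no-carry n {d} {v} {k} v< =
    split-level n {d} {v} {k} v< (λ ≤v → ⇔.trans (≡⇒⇔ (cong (λ w → w ⊖ k ≡ d) (s₂-above n ≤v v<))) (suc-⊖ _ k d))

  split-no-carry-suc : (n : ℕ) {d : ℤ} {v k : ℕ} → v < 2 ^ suc n →
    NoCarry (suc n) d v (suc k) ⇔ (NoCarry n (d ℤ.+ 1ℤ) v k ⊎ Carry n d v k)
  split-no-carry-suc n {d} {v} {k} v< = ⇔.trans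
    (split-level n {d} {v} {suc k} v< (λ ≤v → ⇔.trans (≡⇒⇔ (cong (λ w → w ⊖ suc k ≡ d) (s₂-above n ≤v v<))) (suc-⊖-suc _ k d)))
    ((⇔.refl ×-⇔ ⊖-suc _ k d) ⊎-⇔ ⇔.refl)

  top-no-carry : (n : ℕ) {d : ℤ} {v k : ℕ} → NoCarry (suc n) d (2 ^ n + v) (suc k) ⇔ NoCarry n d v k
  top-no-carry n {d} {v} {k} =
    shift-no-carry n {d} {d} {v} {k} {suc k} (λ v< → ⇔.trans (≡⇒⇔ (cong (λ w → w ⊖ suc k ≡ d) (s₂-top n v<))) (suc-⊖-suc _ k d))

  top-no-carry-sub : (n : ℕ) {d : ℤ} {v k : ℕ} → NoCarry (suc n) d (2 ^ n + v) k ⇔ NoCarry n (d ℤ.- 1ℤ) v k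
  top-no-carry-sub n {d} {v} {k} =
    shift-no-carry n {d} {d ℤ.- 1ℤ} {v} {k} {k} (λ v< → ⇔.trans (≡⇒⇔ (cong (λ w → w ⊖ k ≡ d) (s₂-top n v<))) (suc-⊖ _ k d))

  top-carry : (n : ℕ) {d : ℤ} {v k : ℕ} → Carry (suc n) d (2 ^ n + v) (suc k) ⇔ Carry n (d ℤ.+ 1ℤ) v k
  top-carry n {d} {v} {k} = shift-carry n {d} {d ℤ.+ 1ℤ} {v} {k} {suc k} (⊖-suc _ k d)

  top-carry-same : (n : ℕ) {d : ℤ} {v k : ℕ} → Carry (suc n) d (2 ^ n + v) k ⇔ Carry n d v k
  top-carry-same n {d} {v} {k} = shift-carry n {d} {d} {v} {k} {k} ⇔.refl

  wrap-carry : (n : ℕ) {d : ℤ} {v k : ℕ} → v < 2 ^ suc n → Carry (suc n) d (2 ^ suc n + v) k ⇔ NoCarry (suc n) d v k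
  wrap-carry n {d} {v} {k} v< = mk⇔ (λ (_ , e) → v< , subst (λ w → s₂ w ⊖ k ≡ d) rest e)
                                    (λ (_ , e) → m≤m+n (2 ^ suc n) v , subst (λ w → s₂ w ⊖ k ≡ d) (sym rest) e)
    where
      rest : 2 ^ suc n + v ∸ 2 ^ suc n ≡ v
      rest = m+n∸m≡n (2 ^ suc n) v

-- count1 and count2 with the remainder r_m replaced by an arbitrary R, and their recursion in m.
module Recurrences where
  open Counting
  open Binary using (s₂-top)
  open Events

  -- The events for the summand u and the remainder R: count1 a m d = C₁ m (r a m) d, and
  -- likewise count2 a m d = C₂ m (r a m) d, hold by definition.
  low? : (m R : ℕ) (d : ℤ) (u : ℕ) → Dec (NoCarry m d (u + R) (s₂ u))
  low? m R d u = noCarry? m d (u + R) (s₂ u)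

  high? : (m R : ℕ) (d : ℤ) (u : ℕ) → Dec (Carry m d (u + R) (s₂ u))
  high? m R d u = carry? m d (u + R) (s₂ u)

  C₁ : ℕ → ℕ → ℤ → ℕ
  C₁ m R d = count (low? m R d) (2 ^ m)

  C₂ : ℕ → ℕ → ℤ → ℕ
  C₂ m R d = count (high? m R d) (2 ^ m)

  sum< : (n : ℕ) {u R : ℕ} → u < 2 ^ n → R < 2 ^ n → u + R < 2 ^ suc n
  sum< n {u} {R} u< R< = subst (u + R <_) (sym (2^suc n)) (+-mono-< u< R<)

  add-top : (n u R : ℕ) → u + (2 ^ n + R) ≡ 2 ^ n + (u + R)
  add-top n u R = x∙yz≈y∙xz u (2 ^ n) R

  both-top : (n u R : ℕ) → (2 ^ n + u) + (2 ^ n + R) ≡ 2 ^ suc n + (u + R)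
  both-top n u R = trans (interchange (2 ^ n) u (2 ^ n) R) (cong (_+ (u + R)) (sym (2^suc n)))

  -- New digit a_n = 0: R is unchanged.
  C₁-step-0 : (n R : ℕ) (d : ℤ) → R < 2 ^ n → C₁ (suc n) R d ≡ C₁ n R d + C₂ n R (d ℤ.- 1ℤ) + C₁ n R d
  C₁-step-0 n R d R< = trans (count-halves (low? (suc n) R d) n) (cong₂ _+_ lower upper)
    where
      lower : count (low? (suc n) R d) (2 ^ n) ≡ C₁ n R d + C₂ n R (d ℤ.- 1ℤ)
      lower = count-⊎ (low? (suc n) R d) (low? n R d) (high? n R (d ℤ.- 1ℤ)) (2 ^ n)
                (λ u u< → split-no-carry n {d} {u + R} {s₂ u} (sum< n u< R<)) (λ _ (v< , _) (≤v , _) → <⇒≱ v< ≤v)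
      upper : count (λ u → low? (suc n) R d (2 ^ n + u)) (2 ^ n) ≡ C₁ n R d
      upper = count-⇔ (λ u → low? (suc n) R d (2 ^ n + u)) (low? n R d) (2 ^ n)
                (λ u u< → ⇔.trans (reindex (NoCarry (suc n) d) (+-assoc (2 ^ n) u R) (s₂-top n u<)) (top-no-carry n {d} {u + R} {s₂ u}))

  C₂-step-0 : (n R : ℕ) (d : ℤ) → R < 2 ^ n → C₂ (suc n) R d ≡ C₂ n R (d ℤ.+ 1ℤ)
  C₂-step-0 n R d R< = trans (count-halves (high? (suc n) R d) n) (cong₂ _+_ lower upper)
    where
      lower : count (high? (suc n) R d) (2 ^ n) ≡ 0
      lower = count-none (high? (suc n) R d) (2 ^ n) (λ u u< (≤v , _) → <⇒≱ (sum< n u< R<) ≤v)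
      upper : count (λ u → high? (suc n) R d (2 ^ n + u)) (2 ^ n) ≡ C₂ n R (d ℤ.+ 1ℤ)
      upper = count-⇔ (λ u → high? (suc n) R d (2 ^ n + u)) (high? n R (d ℤ.+ 1ℤ)) (2 ^ n)
                (λ u u< → ⇔.trans (reindex (Carry (suc n) d) (+-assoc (2 ^ n) u R) (s₂-top n u<)) (top-carry n {d} {u + R} {s₂ u}))

  -- New digit a_n = 1: R becomes 2^n + R.
  C₁-step-1 : (n R : ℕ) (d : ℤ) → R < 2 ^ n → C₁ (suc n) (2 ^ n + R) d ≡ C₁ n R (d ℤ.- 1ℤ)
  C₁-step-1 n R d R< = trans (count-halves (low? (suc n) (2 ^ n + R) d) n)
                             (trans (cong₂ _+_ lower upper) (+-identityʳ (C₁ n R (d ℤ.- 1ℤ))))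
    where
      lower : count (low? (suc n) (2 ^ n + R) d) (2 ^ n) ≡ C₁ n R (d ℤ.- 1ℤ)
      lower = count-⇔ (low? (suc n) (2 ^ n + R) d) (low? n R (d ℤ.- 1ℤ)) (2 ^ n)
                (λ u u< → ⇔.trans (reindex (NoCarry (suc n) d) {k = s₂ u} (add-top n u R) refl) (top-no-carry-sub n {d} {u + R} {s₂ u}))
      upper : count (λ u → low? (suc n) (2 ^ n + R) d (2 ^ n + u)) (2 ^ n) ≡ 0
      upper = count-none (λ u → low? (suc n) (2 ^ n + R) d (2 ^ n + u)) (2 ^ n)
                (λ u u< (v< , _) → <⇒≱ v< (subst (2 ^ suc n ≤_) (sym (both-top n u R)) (m≤m+n (2 ^ suc n) (u + R))))

  C₂-step-1 : (n R : ℕ) (d : ℤ) → R < 2 ^ n → C₂ (suc n) (2 ^ n + R) d ≡ C₂ n R d + (C₁ n R (d ℤ.+ 1ℤ) + C₂ n R d)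
  C₂-step-1 n R d R< = trans (count-halves (high? (suc n) (2 ^ n + R) d) n) (cong₂ _+_ lower upper)
    where
      lower : count (high? (suc n) (2 ^ n + R) d) (2 ^ n) ≡ C₂ n R d
      lower = count-⇔ (high? (suc n) (2 ^ n + R) d) (high? n R d) (2 ^ n)
                (λ u u< → ⇔.trans (reindex (Carry (suc n) d) {k = s₂ u} (add-top n u R) refl) (top-carry-same n {d} {u + R} {s₂ u}))
      upper : count (λ u → high? (suc n) (2 ^ n + R) d (2 ^ n + u)) (2 ^ n) ≡ C₁ n R (d ℤ.+ 1ℤ) + C₂ n R d
      upper = count-⊎ (λ u → high? (suc n) (2 ^ n + R) d (2 ^ n + u)) (low? n R (d ℤ.+ 1ℤ)) (high? n R d) (2 ^ n)
                (λ u u< → ⇔.trans (reindex (Carry (suc n) d) (both-top n u R) (s₂-top n u<))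
                            (⇔.trans (wrap-carry n {d} {u + R} {suc (s₂ u)} (sum< n u< R<)) (split-no-carry-suc n {d} {u + R} {s₂ u} (sum< n u< R<))))
                (λ _ (v< , _) (≤v , _) → <⇒≱ v< ≤v)

-- Dyadic fractions c/2^n, in terms of which η¹ and η² are written: the identities needed when
-- passing from denominator 2^n to 2^(n+1).  They are checked on unnormalised fractions.
module Dyadic where
  open +-*-Solver

  -- c / 2^n; by definition η¹ a n d = dyadic (count1 a n d) n, and likewise for η².
  dyadic : ℕ → ℕ → ℚ
  dyadic c n = ℚ._/_ (ℤ.+ c) (2 ^ n) {{2^-nz n}}

  toℚᵘ-/ : (i : ℤ) (k : ℕ) → toℚᵘ (i ℚ./ suc k) ≃ᵘ mkℚᵘ i k
  toℚᵘ-/ i k = ℚP.toℚᵘ-fromℚᵘ (mkℚᵘ i k)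

  toℚᵘ-½* : (q k : ℕ) → toℚᵘ (½ ℚ.* (ℤ.+ q ℚ./ suc k)) ≃ᵘ mkℚᵘ 1ℤ 1 ℚᵘ.* mkℚᵘ (ℤ.+ q) k
  toℚᵘ-½* q k = ≃-trans (ℚP.toℚᵘ-homo-* ½ (ℤ.+ q ℚ./ suc k)) (*-cong (≃-refl {mkℚᵘ 1ℤ 1}) (toℚᵘ-/ (ℤ.+ q) k))

  via-ℚᵘ : {x y : ℚ} (x′ y′ : ℚᵘ) → toℚᵘ x ≃ᵘ x′ → toℚᵘ y ≃ᵘ y′ → x′ ≃ᵘ y′ → x ≡ y
  via-ℚᵘ _ _ x≃ y≃ x′≃y′ = ℚP.toℚᵘ-injective (≃-trans x≃ (≃-trans x′≃y′ (≃-sym y≃)))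

  /-half : (q N M : ℕ) .{{_ : NonZero N}} .{{_ : NonZero M}} → M ≡ 2 * N →
    ℤ.+ q ℚ./ M ≡ ½ ℚ.* (ℤ.+ q ℚ./ N)
  /-half q (suc k) .(2 * suc k) refl = via-ℚᵘ _ _ (toℚᵘ-/ (ℤ.+ q) _) (toℚᵘ-½* q k)
    (*≡* (solve 2 (λ q k → q :* (con (ℤ.+ 2) :* k) := (con 1ℤ :* q) :* (con (ℤ.+ 2) :* k)) refl (ℤ.+ q) (ℤ.+ suc k)))

  /-mix : (p q N M : ℕ) .{{_ : NonZero N}} .{{_ : NonZero M}} → M ≡ 2 * N →
    ℤ.+ (p + q + p) ℚ./ M ≡ (ℤ.+ p ℚ./ N) ℚ.+ ½ ℚ.* (ℤ.+ q ℚ./ N)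
  /-mix p q (suc k) .(2 * suc k) refl = via-ℚᵘ _ (mkℚᵘ (ℤ.+ p) k ℚᵘ.+ mkℚᵘ 1ℤ 1 ℚᵘ.* mkℚᵘ (ℤ.+ q) k)
    (toℚᵘ-/ (ℤ.+ (p + q + p)) _)
    (≃-trans (ℚP.toℚᵘ-homo-+ (ℤ.+ p ℚ./ suc k) (½ ℚ.* (ℤ.+ q ℚ./ suc k))) (+-cong (toℚᵘ-/ (ℤ.+ p) k) (toℚᵘ-½* q k)))
    (*≡* (solve 3 (λ p q k → (p :+ q :+ p) :* (k :* (con (ℤ.+ 2) :* k))
                             := (p :* (con (ℤ.+ 2) :* k) :+ (con 1ℤ :* q) :* k) :* (con (ℤ.+ 2) :* k))
                  refl (ℤ.+ p) (ℤ.+ q) (ℤ.+ suc k)))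

  dyadic-half : (q n : ℕ) → dyadic q (suc n) ≡ ½ ℚ.* dyadic q n
  dyadic-half q n = /-half q (2 ^ n) (2 ^ suc n) {{2^-nz n}} {{2^-nz (suc n)}} refl

  dyadic-mix : (p q n : ℕ) → dyadic (p + q + p) (suc n) ≡ dyadic p n ℚ.+ ½ ℚ.* dyadic q n
  dyadic-mix p q n = /-mix p q (2 ^ n) (2 ^ suc n) {{2^-nz n}} {{2^-nz (suc n)}} refl

open Binary using (r-suc)
open Recurrences using (C₁; C₂; C₁-step-0; C₂-step-0; C₁-step-1; C₂-step-1)
open Dyadic using (dyadic; dyadic-half; dyadic-mix)

digit-bit : (a n : ℕ) → Fin.toℕ (digit a n) ≡ bit a n
digit-bit a n = toℕ-fromℕ< _

r< : (a n : ℕ) → r a n < 2 ^ n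
r< a n = m%n<n a (2 ^ n) {{2^-nz n}}

step-0 : (a n : ℕ) (d : ℤ) → bit a n ≡ 0 →
  (η¹ a (suc n) d ≡ η¹ a n d ℚ.+ ½ ℚ.* η² a n (d ℤ.- 1ℤ)) × (η² a (suc n) d ≡ ½ ℚ.* η² a n (d ℤ.+ 1ℤ))
step-0 a n d a≡0 = trans (cong (λ c → dyadic c (suc n)) η¹-count) (dyadic-mix (C₁ n (r a n) d) (C₂ n (r a n) (d ℤ.- 1ℤ)) n)
                 , trans (cong (λ c → dyadic c (suc n)) η²-count) (dyadic-half (C₂ n (r a n) (d ℤ.+ 1ℤ)) n)
  where
    R≡ : r a (suc n) ≡ r a n
    R≡ = trans (r-suc a n) (trans (cong (λ b → r a n + b * 2 ^ n) a≡0) (+-identityʳ (r a n)))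
    η¹-count : C₁ (suc n) (r a (suc n)) d ≡ C₁ n (r a n) d + C₂ n (r a n) (d ℤ.- 1ℤ) + C₁ n (r a n) d
    η¹-count = trans (cong (λ R → C₁ (suc n) R d) R≡) (C₁-step-0 n (r a n) d (r< a n))
    η²-count : C₂ (suc n) (r a (suc n)) d ≡ C₂ n (r a n) (d ℤ.+ 1ℤ)
    η²-count = trans (cong (λ R → C₂ (suc n) R d) R≡) (C₂-step-0 n (r a n) d (r< a n))

step-1 : (a n : ℕ) (d : ℤ) → bit a n ≡ 1 →
  (η¹ a (suc n) d ≡ ½ ℚ.* η¹ a n (d ℤ.- 1ℤ)) × (η² a (suc n) d ≡ ½ ℚ.* η¹ a n (d ℤ.+ 1ℤ) ℚ.+ η² a n d)
step-1 a n d a≡1 = trans (cong (λ c → dyadic c (suc n)) η¹-count) (dyadic-half (C₁ n (r a n) (d ℤ.- 1ℤ)) n)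
                 , trans (cong (λ c → dyadic c (suc n)) η²-count)
                         (trans (dyadic-mix (C₂ n (r a n) d) (C₁ n (r a n) (d ℤ.+ 1ℤ)) n)
                                (ℚP.+-comm (η² a n d) (½ ℚ.* η¹ a n (d ℤ.+ 1ℤ))))
  where
    R≡ : r a (suc n) ≡ 2 ^ n + r a n
    R≡ = trans (r-suc a n) (trans (cong (λ b → r a n + b * 2 ^ n) a≡1) (trans (cong (r a n +_) (+-identityʳ (2 ^ n))) (ℕP.+-comm (r a n) (2 ^ n))))
    η¹-count : C₁ (suc n) (r a (suc n)) d ≡ C₁ n (r a n) (d ℤ.- 1ℤ)
    η¹-count = trans (cong (λ R → C₁ (suc n) R d) R≡) (C₁-step-1 n (r a n) d (r< a n))
    η²-count : C₂ (suc n) (r a (suc n)) d ≡ C₂ n (r a n) d + C₁ n (r a n) (d ℤ.+ 1ℤ) + C₂ n (r a n) d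
    η²-count = trans (cong (λ R → C₂ (suc n) R d) R≡)
                     (trans (C₂-step-1 n (r a n) d (r< a n)) (sym (+-assoc (C₂ n (r a n) d) (C₁ n (r a n) (d ℤ.+ 1ℤ)) (C₂ n (r a n) d))))

transition : (a n : ℕ) (d : ℤ) (f : Fin 2) → Fin.toℕ f ≡ bit a n →
    (η¹ a (suc n) d ≡ proj₁ (A f (η¹ a n , η² a n)) d)
    × (η² a (suc n) d ≡ proj₂ (A f (η¹ a n , η² a n)) d)
transition a n d Fin.zero 0≡a = step-0 a n d (sym 0≡a)
transition a n d (Fin.suc Fin.zero) 1≡a = step-1 a n d (sym 1≡a)

lemma3 : (a n : ℕ) → (d : ℤ) →
    (η¹ a (suc n) d ≡ proj₁ (A (digit a n) (η¹ a n , η² a n)) d)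
    × (η² a (suc n) d ≡ proj₂ (A (digit a n) (η¹ a n , η² a n)) d)
lemma3 a n d = transition a n d (digit a n) (digit-bit a n)
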